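{- For arbitrarily large positive integers $n$, there is a set $A\subseteq\{1,\ldots,2\cdot 16^n\}$ with $|A|=2^n$ such that \[R_2(A-A)\leq 3\] and \[C(A-A)\leq 2n.\]
   Context: $A-A=\{a-a':a,a'\in A\}$. A finite increasing sequence $a_1<\cdots<a_n$ is strictly convex if the sequence of first differences $a_{i+1}-a_i$ is strictly monotone; $C(B)$ denotes the length of the longest strictly convex sequence contained in $B$. For $L\geq 1$, a finite increasing sequence of real numbers $a_1<\cdots<a_n$ is called $L$-regular if there is a positive real number $X$ such that $X\leq a_{i+1}-a_i\leq LX$ for all $i=1,\ldots,n-1$. For a set $B$ of real numbers, $R_L(B)=\max\{|B'|:B'\subseteq B,\ B'\text{ is }L\text{ -regular}\}$.
   Formalization: The scale X in the definition of an L-regular sequence ranges over the positive rationals instead of the positive reals. -}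

module Defs where

open import Data.Nat using (ℕ; zero; suc; _^_; _≤_) renaming (_*_ to _*ℕ_)
open import Data.Integer using (ℤ; +_) renaming (_-_ to _-ℤ_; _<_ to _<ℤ_; _>_ to _>ℤ_)
open import Data.Rational using (ℚ; _/_; 0ℚ) renaming (_≤_ to _≤ℚ_; _<_ to _<ℚ_; _*_ to _*ℚ_)
open import Data.List using (List; []; _∷_; length)
open import Data.List.Relation.Unary.All using (All)
open import Data.List.Relation.Unary.Linked using (Linked)
open import Data.List.Membership.Propositional using (_∈_)
open import Data.Product using (Σ; ∃; _×_)
open import Data.Sum using (_⊎_)
open import Relation.Binary.PropositionalEquality using (_≡_)

ℤSet : Set₁
ℤSet = ℤ → Set

DiffSet : List ℕ → ℤSet
DiffSet A d = Σ ℕ λ a → Σ ℕ λ a' → a ∈ A × a' ∈ A × d ≡ (+ a) -ℤ (+ a')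

Increasing : List ℤ → Set
Increasing = Linked _<ℤ_

diffs : List ℤ → List ℤ
diffs [] = []
diffs (x ∷ []) = []
diffs (x ∷ y ∷ xs) = (y -ℤ x) ∷ diffs (y ∷ xs)

StrictlyConvex : List ℤ → Set
StrictlyConvex xs = Increasing xs × (Linked _<ℤ_ (diffs xs) ⊎ Linked _>ℤ_ (diffs xs))

toℚ : ℤ → ℚ
toℚ z = z / 1

Regular : ℚ → List ℤ → Set
Regular L xs = Increasing xs × ∃ λ (X : ℚ) → 0ℚ <ℚ X ×
  All (λ d → X ≤ℚ toℚ d × toℚ d ≤ℚ L *ℚ X) (diffs xs)

_⊆ˡ_ : List ℤ → ℤSet → Set
xs ⊆ˡ B = All B xs

-- R_L(B) ≤ k : every L-regular subset of B has at most k elements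
-- (a finite subset of B is represented by its increasing enumeration).
R≤ : ℚ → ℤSet → ℕ → Set
R≤ L B k = (xs : List ℤ) → xs ⊆ˡ B → Regular L xs → length xs ≤ k

C≤ : ℤSet → ℕ → Set
C≤ B k = (xs : List ℤ) → xs ⊆ˡ B → StrictlyConvex xs → length xs ≤ k

module Submission where

-- A n is {1 + Σ_{i<n} bᵢ 16^i : bᵢ ∈ {0,1}}, so A n - A n is the set of sums
-- Σ_{i<n} εᵢ 16^i with εᵢ ∈ {-1,0,1}, all of absolute value at most r n = (16^n - 1)/15.
-- Split such sums by their leading digit ε_n: two points with the same leading digit are
-- at distance ≤ 2 r n, points with different leading digits at distance
-- > 16^n - 2 r n > 4 r n, and along an increasing sequence the leading digit can change
-- at most twice.  Hence among the three gaps of a 2-regular sequence of four points one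
-- keeps the leading digit, so none may change it (it would be more than twice as long),
-- and all four points descend to one level lower.  In a strictly convex
-- sequence with decreasing gaps, once a gap keeps the leading digit so do all later ones,
-- so at most two steps precede a tail lying one level lower: the length grows by at most
-- 2 per level, starting from 2 at one digit.  Increasing gaps become decreasing ones
-- under x ↦ -x and reversal.

open import Defs
open import Data.Nat using (ℕ; _≤_; _*_; _^_)
open import Data.Rational using (ℚ; 1ℚ) renaming (_+_ to _+ℚ_)
open import Data.List using (List; length)
open import Data.List.Relation.Unary.All using (All)
open import Data.List.Relation.Unary.Unique.Propositional using (Unique)
open import Data.Product using (Σ; _×_)
open import Relation.Binary.PropositionalEquality using (_≡_)

open import Data.Nat as ℕ using (zero; suc; z≤n; s≤s) renaming (_+_ to _+ℕ_)
import Data.Nat.Properties as ℕP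
open import Data.Integer using (ℤ; +_; -_; _+_; _-_; 0ℤ; 1ℤ; -1ℤ; +≤+; +<+)
  renaming (_*_ to _*ℤ_; _≤_ to _≤ℤ_; _<_ to _<ℤ_; _>_ to _>ℤ_)
import Data.Integer.Properties as ℤP
open import Data.Integer.Tactic.RingSolver using (solve-∀; solve)
import Data.Rational as ℚ
import Data.Rational.Properties as ℚP
import Data.Rational.Unnormalised as ℚᵘ
import Data.Rational.Unnormalised.Properties as ℚᵘP
open import Data.Product using (_,_; proj₁; proj₂; uncurry)
open import Data.Sum using (_⊎_; inj₁; inj₂)
open import Data.Empty using (⊥; ⊥-elim)
open import Data.List using ([]; _∷_; [_]; _++_; map; reverse; _ʳ++_)
import Data.List.Properties as LP
open import Data.List.Relation.Unary.All using ([]; _∷_)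
import Data.List.Relation.Unary.All as All
open import Data.List.Relation.Unary.All.Properties using (++⁻ˡ; map⁺)
open import Data.List.Relation.Unary.Linked using (Linked; []; [-]; _∷_)
open import Data.List.Relation.Unary.AllPairs using ([]; _∷_)
import Data.List.Relation.Unary.Linked as Linked
open import Data.List.Relation.Unary.Linked.Properties using (Linked⇒All)
open import Data.List.Relation.Unary.Any using (here)
open import Data.List.Membership.Propositional using (_∈_)
open import Data.List.Membership.Propositional.Properties using (∈-++⁻; ∈-map⁻)
open import Data.List.Relation.Binary.Disjoint.Propositional using (Disjoint)
import Data.List.Relation.Unary.Unique.Propositional.Properties as Unique
open import Relation.Binary.PropositionalEquality
  using (refl; sym; trans; cong; cong₂; subst; subst₂; module ≡-Reasoning)

r : ℕ → ℕ
r zero = 0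
r (suc n) = r n +ℕ 16 ^ n

1+15r≡16^n : ∀ n → suc (15 * r n) ≡ 16 ^ n
1+15r≡16^n zero = refl
1+15r≡16^n (suc n) = begin
  suc (15 * (r n +ℕ 16 ^ n))     ≡⟨ cong suc (ℕP.*-distribˡ-+ 15 (r n) (16 ^ n)) ⟩
  suc (15 * r n) +ℕ 15 * 16 ^ n   ≡⟨ cong (_+ℕ 15 * 16 ^ n) (1+15r≡16^n n) ⟩
  16 ^ n +ℕ 15 * 16 ^ n           ∎
  where open ≡-Reasoning

6r<16^n : ∀ n → 6 * r n ℕ.< 16 ^ n
6r<16^n n = subst (6 * r n ℕ.<_) (1+15r≡16^n n) (s≤s (ℕP.*-monoˡ-≤ (r n) (ℕP.m≤m+n 6 9)))

r<16^n : ∀ n → r n ℕ.< 16 ^ n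
r<16^n n = ℕP.≤-<-trans (ℕP.m≤n*m (r n) 6) (6r<16^n n)

Q R : ℕ → ℤ
Q n = + (16 ^ n)
R n = + r n

6R<Q : ∀ n → + 6 *ℤ R n <ℤ Q n
6R<Q n = subst (_<ℤ Q n) (ℤP.pos-* 6 (r n)) (+<+ (6r<16^n n))

infix 4 _∈[±_]
_∈[±_] : ℤ → ℤ → Set
x ∈[± a ] = - a ≤ℤ x × x ≤ℤ a

∈[±]-+ : ∀ {a b x y} → x ∈[± a ] → y ∈[± b ] → x + y ∈[± a + b ]
∈[±]-+ {a} {b} (a≤x , x≤a) (b≤y , y≤b) =
  subst (_≤ℤ _) (sym (ℤP.neg-distrib-+ a b)) (ℤP.+-mono-≤ a≤x b≤y) , ℤP.+-mono-≤ x≤a y≤b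

∈[±]-diff : ∀ {a x y} → x ∈[± a ] → y ∈[± a ] → x - y ∈[± + 2 *ℤ a ]
∈[±]-diff {a} {x} {y} (a≤x , x≤a) (a≤y , y≤a) = lower , upper
  where
  open ℤP.≤-Reasoning
  lower : - (+ 2 *ℤ a) ≤ℤ x - y
  lower = begin
    - (+ 2 *ℤ a) ≡⟨ solve [ a ] ⟩
    - a - a      ≤⟨ ℤP.+-mono-≤ a≤x (ℤP.neg-mono-≤ y≤a) ⟩
    x - y        ∎
  upper : x - y ≤ℤ + 2 *ℤ a
  upper = begin
    x - y        ≤⟨ ℤP.+-mono-≤ x≤a (ℤP.neg-mono-≤ a≤y) ⟩
    a - - a      ≡⟨ solve [ a ] ⟩
    + 2 *ℤ a     ∎

data Digit : Set where
  neg zer pos : Digit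

⟦_⟧ : Digit → ℤ
⟦ neg ⟧ = -1ℤ
⟦ zer ⟧ = 0ℤ
⟦ pos ⟧ = 1ℤ

opposite : Digit → Digit
opposite neg = pos
opposite zer = zer
opposite pos = neg

⟦opposite⟧ : ∀ d → ⟦ opposite d ⟧ ≡ - ⟦ d ⟧
⟦opposite⟧ neg = refl
⟦opposite⟧ zer = refl
⟦opposite⟧ pos = refl

data _<ᵈ_ : Digit → Digit → Set where
  neg<zer : neg <ᵈ zer
  neg<pos : neg <ᵈ pos
  zer<pos : zer <ᵈ pos

<ᵈ-trichotomy : ∀ d d' → d ≡ d' ⊎ d <ᵈ d' ⊎ d' <ᵈ d
<ᵈ-trichotomy neg neg = inj₁ refl
<ᵈ-trichotomy neg zer = inj₂ (inj₁ neg<zer)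
<ᵈ-trichotomy neg pos = inj₂ (inj₁ neg<pos)
<ᵈ-trichotomy zer neg = inj₂ (inj₂ neg<zer)
<ᵈ-trichotomy zer zer = inj₁ refl
<ᵈ-trichotomy zer pos = inj₂ (inj₁ zer<pos)
<ᵈ-trichotomy pos neg = inj₂ (inj₂ neg<pos)
<ᵈ-trichotomy pos zer = inj₂ (inj₂ zer<pos)
<ᵈ-trichotomy pos pos = inj₁ refl

digitsAbove : Digit → ℕ
digitsAbove neg = 2
digitsAbove zer = 1
digitsAbove pos = 0

digitsAbove-< : ∀ {d d'} → d <ᵈ d' → suc (digitsAbove d') ≤ digitsAbove d
digitsAbove-< neg<zer = s≤s (s≤s z≤n)
digitsAbove-< neg<pos = s≤s z≤n
digitsAbove-< zer<pos = s≤s z≤n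

digitsAbove≤2 : ∀ d → digitsAbove d ≤ 2
digitsAbove≤2 neg = s≤s (s≤s z≤n)
digitsAbove≤2 zer = s≤s z≤n
digitsAbove≤2 pos = z≤n

-i≤i : ∀ {i} → 0ℤ ≤ℤ i → - i ≤ℤ i
-i≤i 0≤i = ℤP.≤-trans (ℤP.neg-mono-≤ 0≤i) 0≤i

digit-bounded : ∀ d {q} → 0ℤ ≤ℤ q → ⟦ d ⟧ *ℤ q ∈[± q ]
digit-bounded neg {q} 0≤q = subst (_∈[± q ]) (sym (-1*i≡-i q)) (ℤP.≤-refl , -i≤i 0≤q)
  where
  -1*i≡-i : ∀ i → -1ℤ *ℤ i ≡ - i
  -1*i≡-i = solve-∀
digit-bounded zer 0≤q = ℤP.neg-mono-≤ 0≤q , 0≤q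
digit-bounded pos {q} 0≤q = subst (_∈[± q ]) (sym (ℤP.*-identityˡ q)) (-i≤i 0≤q , ℤP.≤-refl)

digit-climb : ∀ {d d' q} → d <ᵈ d' → 0ℤ ≤ℤ q → q ≤ℤ ⟦ d' ⟧ *ℤ q - ⟦ d ⟧ *ℤ q
digit-climb {q = q} neg<zer _ = ℤP.≤-reflexive (solve [ q ])
digit-climb {q = q} neg<pos 0≤q = begin
  q                      ≡⟨ solve [ q ] ⟩
  q + 0ℤ                 ≤⟨ ℤP.+-monoʳ-≤ q 0≤q ⟩
  q + q                  ≡⟨ solve [ q ] ⟩
  1ℤ *ℤ q - -1ℤ *ℤ q     ∎
  where open ℤP.≤-Reasoning
digit-climb {q = q} zer<pos _ = ℤP.≤-reflexive (solve [ q ])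

-- Digits n c x: x + c = Σ_{i<n} εᵢ 16^i with all εᵢ ∈ {-1, 0, 1}, leading digit first.
-- The offset c lets a sequence be followed into the block of a fixed leading digit.
data Digits : ℕ → ℤ → ℤ → Set where
  nil : ∀ {c x} → x + c ≡ 0ℤ → Digits zero c x
  _∷_ : ∀ {n c x} d → Digits n (c - ⟦ d ⟧ *ℤ Q n) x → Digits (suc n) c x

leading : ∀ {n c x} → Digits (suc n) c x → Digit
leading (d ∷ _) = d

Digits-transport : ∀ {n c c' x x'} → x + c ≡ x' + c' → Digits n c x → Digits n c' x'
Digits-transport eq (nil e) = nil (trans (sym eq) e)
Digits-transport {suc n} {c} {c'} {x} {x'} eq (d ∷ h) = d ∷ Digits-transport shifted h
  where
  s : ℤ
  s = ⟦ d ⟧ *ℤ Q n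
  shifted : x + (c - s) ≡ x' + (c' - s)
  shifted = trans (sym (ℤP.+-assoc x c (- s))) (trans (cong (_- s) eq) (ℤP.+-assoc x' c' (- s)))

Digits-bounded : ∀ {n c x} → Digits n c x → x + c ∈[± R n ]
Digits-bounded (nil e) = subst (_∈[± 0ℤ ]) (sym e) (ℤP.≤-refl , ℤP.≤-refl)
Digits-bounded {suc n} {c} {x} (d ∷ h) =
  subst (_∈[± R (suc n) ]) (cancel x c (⟦ d ⟧ *ℤ Q n))
    (∈[±]-+ (Digits-bounded h) (digit-bounded d (+≤+ z≤n)))
  where
  cancel : ∀ x c s → (x + (c - s)) + s ≡ x + c
  cancel = solve-∀

Digits-neg : ∀ {n c x} → Digits n c x → Digits n (- c) (- x)
Digits-neg {c = c} {x} (nil e) = nil (trans (sym (ℤP.neg-distrib-+ x c)) (cong -_ e))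
Digits-neg {suc n} {c} {x} (d ∷ h) = opposite d ∷ Digits-transport (cong (λ y → - x + y) negated) (Digits-neg h)
  where
  neg-minus : ∀ c t q → - (c - t *ℤ q) ≡ - c - (- t) *ℤ q
  neg-minus = solve-∀
  negated : - (c - ⟦ d ⟧ *ℤ Q n) ≡ - c - ⟦ opposite d ⟧ *ℤ Q n
  negated = trans (neg-minus c ⟦ d ⟧ (Q n)) (cong (λ t → - c - t *ℤ Q n) (sym (⟦opposite⟧ d)))

stay-gap : ∀ {n c x x'} → Digits n c x → Digits n c x' → x' - x ≤ℤ + 2 *ℤ R n
stay-gap {c = c} {x} {x'} h h' = subst (_≤ℤ _) (translation-invariant x x' c)
  (proj₂ (∈[±]-diff (Digits-bounded h') (Digits-bounded h)))
  where
  translation-invariant : ∀ x x' c → (x' + c) - (x + c) ≡ x' - x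
  translation-invariant = solve-∀

gap-decomposition : ∀ x x' c s s' → x' - x ≡ ((x' + (c - s')) - (x + (c - s))) + (s' - s)
gap-decomposition = solve-∀

climb-gap : ∀ {n c x x'} (h : Digits (suc n) c x) (h' : Digits (suc n) c x') →
  leading h <ᵈ leading h' → + 4 *ℤ R n <ℤ x' - x
climb-gap {n} {c} {x} {x'} (d ∷ h) (d' ∷ h') d<d' = begin-strict
  + 4 *ℤ R n                     ≡⟨ four-r (R n) ⟩
  - (+ 2 *ℤ R n) + + 6 *ℤ R n    <⟨ ℤP.+-monoʳ-< (- (+ 2 *ℤ R n)) (6R<Q n) ⟩
  - (+ 2 *ℤ R n) + Q n           ≤⟨ ℤP.+-mono-≤ (proj₁ (∈[±]-diff (Digits-bounded h') (Digits-bounded h)))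
                                                 (digit-climb d<d' (+≤+ z≤n)) ⟩
  _                              ≡⟨ gap-decomposition x x' c _ _ ⟨
  x' - x                         ∎
  where
  open ℤP.≤-Reasoning
  four-r : ∀ r → + 4 *ℤ r ≡ - (+ 2 *ℤ r) + + 6 *ℤ r
  four-r = solve-∀

climb-reversed : ∀ {r x x'} → 0ℤ ≤ℤ r → x <ℤ x' → + 4 *ℤ r <ℤ x - x' → ⊥
climb-reversed {r} {x} {x'} 0≤r x<x' 4r<x-x' = ℤP.<-irrefl refl (begin-strict
  0ℤ            ≤⟨ ℤP.*-monoˡ-≤-nonNeg (+ 4) 0≤r ⟩
  + 4 *ℤ r      <⟨ 4r<x-x' ⟩
  x - x'        <⟨ ℤP.+-monoˡ-< (- x') x<x' ⟩
  x' - x'       ≡⟨ ℤP.+-inverseʳ x' ⟩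
  0ℤ            ∎)
  where open ℤP.≤-Reasoning

data Step (n : ℕ) (d d' : Digit) (g : ℤ) : Set where
  stay  : d ≡ d' → g ≤ℤ + 2 *ℤ R n → Step n d d' g
  climb : d <ᵈ d' → + 4 *ℤ R n <ℤ g → Step n d d' g

step : ∀ {n c x x'} (h : Digits (suc n) c x) (h' : Digits (suc n) c x') → x <ℤ x' →
  Step n (leading h) (leading h') (x' - x)
step {n} hd@(d ∷ h) hd'@(d' ∷ h') x<x' with <ᵈ-trichotomy d d'
... | inj₁ refl = stay refl (stay-gap h h')
... | inj₂ (inj₁ d<d') = climb d<d' (climb-gap hd hd' d<d')
... | inj₂ (inj₂ d'<d) = ⊥-elim (climb-reversed {R n} (+≤+ z≤n) x<x' (climb-gap hd' hd d'<d))

climb-exceeds-twice-stay : ∀ {r g h} → + 4 *ℤ r <ℤ g → h ≤ℤ + 2 *ℤ r → g ≤ℤ h + h → ⊥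
climb-exceeds-twice-stay {r} {g} {h} 4r<g h≤2r g≤2h = ℤP.<-irrefl refl (begin-strict
  g                      ≤⟨ g≤2h ⟩
  h + h                  ≤⟨ ℤP.+-mono-≤ h≤2r h≤2r ⟩
  + 2 *ℤ r + + 2 *ℤ r    ≡⟨ solve [ r ] ⟩
  + 4 *ℤ r               <⟨ 4r<g ⟩
  g                      ∎)
  where open ℤP.≤-Reasoning

climb-not-stay : ∀ {r g} → 0ℤ ≤ℤ r → + 4 *ℤ r <ℤ g → g ≤ℤ + 2 *ℤ r → ⊥
climb-not-stay {r} {g} 0≤r 4r<g g≤2r = ℤP.<-irrefl refl (begin-strict
  g                      ≤⟨ g≤2r ⟩
  + 2 *ℤ r               ≡⟨ ℤP.+-identityʳ (+ 2 *ℤ r) ⟨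
  + 2 *ℤ r + 0ℤ          ≤⟨ ℤP.+-monoʳ-≤ (+ 2 *ℤ r) (ℤP.*-monoˡ-≤-nonNeg (+ 2) 0≤r) ⟩
  + 2 *ℤ r + + 2 *ℤ r    ≡⟨ solve [ r ] ⟩
  + 4 *ℤ r               <⟨ 4r<g ⟩
  g                      ∎)
  where open ℤP.≤-Reasoning

TwiceBounded : List ℤ → Set
TwiceBounded gs = All (λ g → All (λ h → g ≤ℤ h + h) gs) gs

TwiceBounded-++⁻ˡ : ∀ gs {hs} → TwiceBounded (gs ++ hs) → TwiceBounded gs
TwiceBounded-++⁻ˡ gs tb = All.map (++⁻ˡ gs) (++⁻ˡ gs tb)

no-four-point : ∀ {n c x₁ x₂ x₃ x₄} →
  Digits n c x₁ → Digits n c x₂ → Digits n c x₃ → Digits n c x₄ →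
  x₁ <ℤ x₂ → x₂ <ℤ x₃ → x₃ <ℤ x₄ → TwiceBounded (x₂ - x₁ ∷ x₃ - x₂ ∷ x₄ - x₃ ∷ []) → ⊥
no-four-point {c = c} (nil e₁) (nil e₂) _ _ x₁<x₂ _ _ _ =
  ℤP.<-irrefl refl (subst₂ _<ℤ_ e₁ e₂ (ℤP.+-monoˡ-< c x₁<x₂))
no-four-point {suc n} {_} {x₁} {x₂} {x₃} {x₄}
  hd₁@(d₁ ∷ h₁) hd₂@(d₂ ∷ h₂) hd₃@(d₃ ∷ h₃) hd₄@(d₄ ∷ h₄) l₁ l₂ l₃
  tb@((_ ∷ b₁₂ ∷ b₁₃ ∷ []) ∷ (b₂₁ ∷ _) ∷ (b₃₁ ∷ _) ∷ []) =
  steps (step hd₁ hd₂ l₁) (step hd₂ hd₃ l₂) (step hd₃ hd₄ l₃)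
  where
  steps : Step n d₁ d₂ (x₂ - x₁) → Step n d₂ d₃ (x₃ - x₂) → Step n d₃ d₄ (x₄ - x₃) → ⊥
  steps (stay refl _) (stay refl _) (stay refl _) = no-four-point h₁ h₂ h₃ h₄ l₁ l₂ l₃ tb
  steps (climb _ big) (stay _ small) _ = climb-exceeds-twice-stay {R n} big small b₁₂
  steps (climb _ big) (climb _ _) (stay _ small) = climb-exceeds-twice-stay {R n} big small b₁₃
  steps (stay _ small) (climb _ big) _ = climb-exceeds-twice-stay {R n} big small b₂₁
  steps (stay _ small) (stay _ _) (climb _ big) = climb-exceeds-twice-stay {R n} big small b₃₁
  steps (climb neg<zer _) (climb zer<pos _) (climb () _)

toℚᵘ-toℚ : ∀ i → ℚ.toℚᵘ (toℚ i) ℚᵘ.≃ i ℚᵘ./ 1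
toℚᵘ-toℚ i = ℚP.toℚᵘ-fromℚᵘ (i ℚᵘ./ 1)

toℚ-cancel-≤ : ∀ {i j} → toℚ i ℚ.≤ toℚ j → i ≤ℤ j
toℚ-cancel-≤ {i} {j} i≤j
  with ℚᵘP.≤-respʳ-≃ (toℚᵘ-toℚ j) (ℚᵘP.≤-respˡ-≃ (toℚᵘ-toℚ i) (ℚP.toℚᵘ-mono-≤ i≤j))
... | ℚᵘ.*≤* i*1≤j*1 = subst₂ _≤ℤ_ (ℤP.*-identityʳ i) (ℤP.*-identityʳ j) i*1≤j*1

toℚ-homo-+ : ∀ i j → toℚ (i + j) ≡ toℚ i +ℚ toℚ j
toℚ-homo-+ i j = ℚP.toℚᵘ-injective (begin-equality
  ℚ.toℚᵘ (toℚ (i + j))                ≃⟨ toℚᵘ-toℚ (i + j) ⟩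
  (i + j) ℚᵘ./ 1                       ≃⟨ ℚᵘ.*≡* (over-one i j) ⟩
  i ℚᵘ./ 1 ℚᵘ.+ j ℚᵘ./ 1               ≃⟨ ℚᵘP.+-cong (toℚᵘ-toℚ i) (toℚᵘ-toℚ j) ⟨
  ℚ.toℚᵘ (toℚ i) ℚᵘ.+ ℚ.toℚᵘ (toℚ j)  ≃⟨ ℚP.toℚᵘ-homo-+ (toℚ i) (toℚ j) ⟨
  ℚ.toℚᵘ (toℚ i +ℚ toℚ j)             ∎)
  where
  open ℚᵘP.≤-Reasoning
  over-one : ∀ i j → (i + j) *ℤ 1ℤ ≡ (i *ℤ 1ℤ + j *ℤ 1ℤ) *ℤ 1ℤ
  over-one = solve-∀

gap-ratio : ∀ {X g h} → toℚ g ℚ.≤ (1ℚ +ℚ 1ℚ) ℚ.* X → X ℚ.≤ toℚ h → g ≤ℤ h + h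
gap-ratio {X} {g} {h} g≤2X X≤h = toℚ-cancel-≤ (begin
  toℚ g                 ≤⟨ g≤2X ⟩
  (1ℚ +ℚ 1ℚ) ℚ.* X      ≡⟨ ℚP.*-distribʳ-+ X 1ℚ 1ℚ ⟩
  1ℚ ℚ.* X +ℚ 1ℚ ℚ.* X  ≡⟨ cong₂ _+ℚ_ (ℚP.*-identityˡ X) (ℚP.*-identityˡ X) ⟩
  X +ℚ X                ≤⟨ ℚP.+-mono-≤ X≤h X≤h ⟩
  toℚ h +ℚ toℚ h        ≡⟨ toℚ-homo-+ h h ⟨
  toℚ (h + h)           ∎)
  where open ℚP.≤-Reasoning

regular⇒TwiceBounded : ∀ {xs} → Regular (1ℚ +ℚ 1ℚ) xs → TwiceBounded (diffs xs)
regular⇒TwiceBounded (_ , X , _ , gaps) =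
  All.map (λ {g} (_ , g≤2X) → All.map (λ {h} (X≤h , _) → gap-ratio {X} {g} {h} g≤2X X≤h) gaps) gaps

regular-bound : ∀ {n c} xs → xs ⊆ˡ Digits n c → Regular (1ℚ +ℚ 1ℚ) xs → length xs ≤ 3
regular-bound [] _ _ = z≤n
regular-bound (_ ∷ []) _ _ = s≤s z≤n
regular-bound (_ ∷ _ ∷ []) _ _ = s≤s (s≤s z≤n)
regular-bound (_ ∷ _ ∷ _ ∷ []) _ _ = s≤s (s≤s (s≤s z≤n))
regular-bound (x₁ ∷ x₂ ∷ x₃ ∷ x₄ ∷ _) (h₁ ∷ h₂ ∷ h₃ ∷ h₄ ∷ _) reg@(l₁ ∷ l₂ ∷ l₃ ∷ _ , _) =
  ⊥-elim (no-four-point h₁ h₂ h₃ h₄ l₁ l₂ l₃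
    (TwiceBounded-++⁻ˡ (x₂ - x₁ ∷ x₃ - x₂ ∷ x₄ - x₃ ∷ []) (regular⇒TwiceBounded reg)))

same-leading-digit : ∀ {n c x xs} (h : Digits (suc n) c x) → xs ⊆ˡ Digits (suc n) c →
  Increasing (x ∷ xs) → All (_≤ℤ + 2 *ℤ R n) (diffs (x ∷ xs)) →
  (x ∷ xs) ⊆ˡ Digits n (c - ⟦ leading h ⟧ *ℤ Q n)
same-leading-digit (_ ∷ h) [] _ _ = h ∷ []
same-leading-digit {n} hd@(_ ∷ h) (hd'@(_ ∷ h') ∷ hs) (x<x' ∷ inc) (small ∷ smalls)
  with step hd hd' x<x'
... | stay refl _ = h ∷ same-leading-digit hd' hs inc smalls
... | climb _ big = ⊥-elim (climb-not-stay {R n} (+≤+ z≤n) big small)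

decreasing⇒All≤ : ∀ {b g gs} → g ≤ℤ b → Linked _>ℤ_ (g ∷ gs) → All (_≤ℤ b) (g ∷ gs)
decreasing⇒All≤ g≤b dec = Linked⇒All (λ i≥j j≥k → ℤP.≤-trans j≥k i≥j) g≤b (Linked.map ℤP.<⇒≤ dec)

DecreasingGapsBound : ℕ → ℕ → Set
DecreasingGapsBound n b =
  ∀ {c xs} → xs ⊆ˡ Digits n c → Increasing xs → Linked _>ℤ_ (diffs xs) → length xs ≤ b

climb-bound : ∀ {n b} → DecreasingGapsBound n b →
  ∀ {c x xs} (h : Digits (suc n) c x) → xs ⊆ˡ Digits (suc n) c →
  Increasing (x ∷ xs) → Linked _>ℤ_ (diffs (x ∷ xs)) → length (x ∷ xs) ≤ digitsAbove (leading h) +ℕ b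
climb-bound {b = b} bound (d ∷ h) [] _ _ =
  ℕP.≤-trans (bound (h ∷ []) [-] []) (ℕP.m≤n+m b (digitsAbove d))
climb-bound {b = b} bound hd@(d ∷ _) (hd'@(_ ∷ _) ∷ hs) inc@(x<x' ∷ inc') dec
  with step hd hd' x<x'
... | stay refl small =
  ℕP.≤-trans (bound (same-leading-digit hd (hd' ∷ hs) inc (decreasing⇒All≤ small dec)) inc dec)
             (ℕP.m≤n+m b (digitsAbove d))
... | climb d<d' _ =
  ℕP.≤-trans (s≤s (climb-bound bound hd' hs inc' (Linked.tail dec))) (ℕP.+-monoˡ-≤ b (digitsAbove-< d<d'))

gap-positive : ∀ {x x'} → x <ℤ x' → 0ℤ <ℤ x' - x
gap-positive {x} {x'} x<x' = subst (_<ℤ x' - x) (ℤP.+-inverseʳ x) (ℤP.+-monoˡ-< (- x) x<x')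

digit-gap : ∀ {c x x'} (h : Digits 1 c x) (h' : Digits 1 c x') → x' - x ≡ ⟦ leading h' ⟧ - ⟦ leading h ⟧
digit-gap {c} {x} {x'} (d ∷ nil e) (d' ∷ nil e') = begin
  x' - x                                        ≡⟨ gap-decomposition x x' c s s' ⟩
  ((x' + (c - s')) - (x + (c - s))) + (s' - s)  ≡⟨ cong₂ (λ u u' → (u' - u) + (s' - s)) e e' ⟩
  0ℤ + (s' - s)                                 ≡⟨ ℤP.+-identityˡ (s' - s) ⟩
  s' - s                                        ≡⟨ cong₂ _-_ (ℤP.*-identityʳ ⟦ d' ⟧) (ℤP.*-identityʳ ⟦ d ⟧) ⟩
  ⟦ d' ⟧ - ⟦ d ⟧                                ∎
  where
  open ≡-Reasoning
  s s' : ℤ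
  s = ⟦ d ⟧ *ℤ 1ℤ
  s' = ⟦ d' ⟧ *ℤ 1ℤ

no-decreasing-triple : ∀ {c x₁ x₂ x₃} → Digits 1 c x₁ → Digits 1 c x₂ → Digits 1 c x₃ →
  x₁ <ℤ x₂ → x₂ <ℤ x₃ → x₃ - x₂ <ℤ x₂ - x₁ → ⊥
no-decreasing-triple hd₁@(_ ∷ nil e₁) hd₂@(_ ∷ nil e₂) hd₃@(_ ∷ nil e₃) l₁ l₂ g₂<g₁
  with step hd₁ hd₂ l₁ | step hd₂ hd₃ l₂
... | stay _ g₁≤0 | _ = ℤP.<-irrefl refl (ℤP.<-≤-trans (gap-positive l₁) g₁≤0)
... | climb _ _ | stay _ g₂≤0 = ℤP.<-irrefl refl (ℤP.<-≤-trans (gap-positive l₂) g₂≤0)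
... | climb neg<zer _ | climb zer<pos _ =
  ℤP.<-irrefl (trans (digit-gap hd₂ hd₃) (sym (digit-gap hd₁ hd₂))) g₂<g₁
... | climb neg<pos _ | climb () _
... | climb zer<pos _ | climb () _

decreasing-gaps-bound : ∀ m → DecreasingGapsBound (suc m) (2 * suc m)
decreasing-gaps-bound zero [] _ _ = z≤n
decreasing-gaps-bound zero (_ ∷ []) _ _ = s≤s z≤n
decreasing-gaps-bound zero (_ ∷ _ ∷ []) _ _ = s≤s (s≤s z≤n)
decreasing-gaps-bound zero (h₁ ∷ h₂ ∷ h₃ ∷ _) (l₁ ∷ l₂ ∷ _) (g₂<g₁ ∷ _) =
  ⊥-elim (no-decreasing-triple h₁ h₂ h₃ l₁ l₂ g₂<g₁)
decreasing-gaps-bound (suc m) [] _ _ = z≤n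
decreasing-gaps-bound (suc m) {xs = x ∷ xs} (h ∷ hs) inc dec = begin
  length (x ∷ xs)                  ≤⟨ climb-bound (decreasing-gaps-bound m) h hs inc dec ⟩
  digitsAbove (leading h) +ℕ 2 * suc m  ≤⟨ ℕP.+-monoˡ-≤ (2 * suc m) (digitsAbove≤2 (leading h)) ⟩
  2 +ℕ 2 * suc m                   ≡⟨ ℕP.*-suc 2 (suc m) ⟨
  2 * suc (suc m)                  ∎
  where open ℕP.≤-Reasoning

mirror : List ℤ → List ℤ
mirror xs = reverse (map -_ xs)

length-mirror : ∀ xs → length (mirror xs) ≡ length xs
length-mirror xs = trans (LP.length-reverse (map -_ xs)) (LP.length-map -_ xs)

All-ʳ++ : ∀ {P : ℤ → Set} {xs acc} → All P xs → All P acc → All P (xs ʳ++ acc)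
All-ʳ++ [] pacc = pacc
All-ʳ++ (px ∷ pxs) pacc = All-ʳ++ pxs (px ∷ pacc)

mirror-⊆ : ∀ {n c xs} → xs ⊆ˡ Digits n c → mirror xs ⊆ˡ Digits n (- c)
mirror-⊆ hs = All-ʳ++ (map⁺ (All.map Digits-neg hs)) []

neg-gap : ∀ x y → y - x ≡ (- x) - (- y)
neg-gap = solve-∀

-- (- x ∷ - p ∷ acc) mirrors the part of the sequence ending in p, x; xs is what remains.
mirror-onto : ∀ {p x xs acc} →
  Increasing (- x ∷ - p ∷ acc) → Linked _>ℤ_ (diffs (- x ∷ - p ∷ acc)) →
  Increasing (p ∷ x ∷ xs) → Linked _<ℤ_ (diffs (p ∷ x ∷ xs)) →
  Increasing (map -_ xs ʳ++ (- x ∷ - p ∷ acc)) × Linked _>ℤ_ (diffs (map -_ xs ʳ++ (- x ∷ - p ∷ acc)))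
mirror-onto {xs = []} inc dec _ _ = inc , dec
mirror-onto {p} {x} {y ∷ _} inc dec (_ ∷ inc'@(x<y ∷ _)) (px<xy ∷ gaps) =
  mirror-onto (ℤP.neg-mono-< x<y ∷ inc) (subst₂ _<ℤ_ (neg-gap p x) (neg-gap x y) px<xy ∷ dec) inc' gaps

mirror-convex : ∀ {xs} → Increasing xs → Linked _<ℤ_ (diffs xs) →
  Increasing (mirror xs) × Linked _>ℤ_ (diffs (mirror xs))
mirror-convex {[]} _ _ = [] , []
mirror-convex {_ ∷ []} _ _ = [-] , []
mirror-convex {_ ∷ _ ∷ _} inc@(x<y ∷ _) gaps = mirror-onto {acc = []} (ℤP.neg-mono-< x<y ∷ [-]) [-] inc gaps

strictly-convex-bound : ∀ m {c xs} → xs ⊆ˡ Digits (suc m) c → StrictlyConvex xs → length xs ≤ 2 * suc m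
strictly-convex-bound m hs (inc , inj₂ dec) = decreasing-gaps-bound m hs inc dec
strictly-convex-bound m {xs = xs} hs (inc , inj₁ gaps) =
  subst (_≤ 2 * suc m) (length-mirror xs) (uncurry (decreasing-gaps-bound m (mirror-⊆ hs)) (mirror-convex inc gaps))

A : ℕ → List ℕ
A zero = 1 ∷ []
A (suc n) = A n ++ map (_+ℕ 16 ^ n) (A n)

∈-A-suc⁻ : ∀ n {a} → a ∈ A (suc n) → a ∈ A n ⊎ Σ ℕ λ b → b ∈ A n × a ≡ b +ℕ 16 ^ n
∈-A-suc⁻ n a∈ with ∈-++⁻ (A n) a∈
... | inj₁ a∈A = inj₁ a∈A
... | inj₂ a∈map = inj₂ (∈-map⁻ (_+ℕ 16 ^ n) a∈map)

A-bounded : ∀ n {a} → a ∈ A n → 1 ≤ a × a ≤ suc (r n)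
A-bounded zero (here refl) = s≤s z≤n , s≤s z≤n
A-bounded (suc n) a∈ with ∈-A-suc⁻ n a∈
... | inj₁ a∈A =
  proj₁ (A-bounded n a∈A) , ℕP.≤-trans (proj₂ (A-bounded n a∈A)) (s≤s (ℕP.m≤m+n (r n) _))
... | inj₂ (b , b∈A , refl) =
  ℕP.≤-trans (proj₁ (A-bounded n b∈A)) (ℕP.m≤m+n b _) , ℕP.+-monoˡ-≤ (16 ^ n) (proj₂ (A-bounded n b∈A))

A-unique : ∀ n → Unique (A n)
A-unique zero = [] ∷ []
A-unique (suc n) = Unique.++⁺ (A-unique n) (Unique.map⁺ (ℕP.+-cancelʳ-≡ (16 ^ n) _ _) (A-unique n)) disjoint
  where
  disjoint : Disjoint (A n) (map (_+ℕ 16 ^ n) (A n))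
  disjoint (a∈A , a∈map) with ∈-map⁻ (_+ℕ 16 ^ n) a∈map
  ... | b , b∈A , refl = ℕP.<⇒≱
    (ℕP.<-≤-trans (s≤s (r<16^n n)) (ℕP.+-monoˡ-≤ (16 ^ n) (proj₁ (A-bounded n b∈A))))
    (proj₂ (A-bounded n a∈A))

length-A : ∀ n → length (A n) ≡ 2 ^ n
length-A zero = refl
length-A (suc n) = begin
  length (A n ++ map (_+ℕ 16 ^ n) (A n))          ≡⟨ LP.length-++ (A n) ⟩
  length (A n) +ℕ length (map (_+ℕ 16 ^ n) (A n)) ≡⟨ cong (length (A n) +ℕ_) (LP.length-map _ (A n)) ⟩
  length (A n) +ℕ length (A n)                    ≡⟨ cong (λ k → k +ℕ k) (length-A n) ⟩
  2 ^ n +ℕ 2 ^ n                                  ≡⟨ cong (2 ^ n +ℕ_) (ℕP.+-identityʳ (2 ^ n)) ⟨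
  2 ^ suc n                                       ∎
  where open ≡-Reasoning

A-differences : ∀ n {a a'} → a ∈ A n → a' ∈ A n → Digits n 0ℤ (+ a - + a')
A-differences zero (here refl) (here refl) = nil refl
A-differences (suc n) {a} {a'} a∈ a'∈ with ∈-A-suc⁻ n a∈ | ∈-A-suc⁻ n a'∈
... | inj₁ a∈A | inj₁ a'∈A =
  zer ∷ Digits-transport (same-block (+ a) (+ a') (Q n)) (A-differences n a∈A a'∈A)
  where
  same-block : ∀ a a' q → (a - a') + 0ℤ ≡ (a - a') + (0ℤ - 0ℤ *ℤ q)
  same-block = solve-∀
... | inj₂ (b , b∈A , refl) | inj₁ a'∈A =
  pos ∷ Digits-transport (upper-lower (+ b) (+ a') (Q n)) (A-differences n b∈A a'∈A)
  where
  upper-lower : ∀ b a' q → (b - a') + 0ℤ ≡ ((b + q) - a') + (0ℤ - 1ℤ *ℤ q)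
  upper-lower = solve-∀
... | inj₁ a∈A | inj₂ (b' , b'∈A , refl) =
  neg ∷ Digits-transport (lower-upper (+ a) (+ b') (Q n)) (A-differences n a∈A b'∈A)
  where
  lower-upper : ∀ a b' q → (a - b') + 0ℤ ≡ (a - (b' + q)) + (0ℤ - -1ℤ *ℤ q)
  lower-upper = solve-∀
... | inj₂ (b , b∈A , refl) | inj₂ (b' , b'∈A , refl) =
  zer ∷ Digits-transport (upper-upper (+ b) (+ b') (Q n)) (A-differences n b∈A b'∈A)
  where
  upper-upper : ∀ b b' q → (b - b') + 0ℤ ≡ ((b + q) - (b' + q)) + (0ℤ - 0ℤ *ℤ q)
  upper-upper = solve-∀

DiffSet-A⊆Digits : ∀ n {z} → DiffSet (A n) z → Digits n 0ℤ z
DiffSet-A⊆Digits n (_ , _ , a∈ , a'∈ , refl) = A-differences n a∈ a'∈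

theorem7 : (N : ℕ) → Σ ℕ λ n → N ≤ n × 1 ≤ n ×
    Σ (List ℕ) λ A → Unique A × All (λ a → 1 ≤ a × a ≤ 2 * 16 ^ n) A ×
    length A ≡ 2 ^ n × R≤ (1ℚ +ℚ 1ℚ) (DiffSet A) 3 × C≤ (DiffSet A) (2 * n)
theorem7 N = suc N , ℕP.n≤1+n N , s≤s z≤n , A (suc N) , A-unique (suc N) , All.tabulate in-range ,
  length-A (suc N) ,
  (λ xs xs⊆ → regular-bound xs (All.map (DiffSet-A⊆Digits (suc N)) xs⊆)) ,
  (λ xs xs⊆ → strictly-convex-bound N (All.map (DiffSet-A⊆Digits (suc N)) xs⊆))
  where
  in-range : ∀ {a} → a ∈ A (suc N) → 1 ≤ a × a ≤ 2 * 16 ^ suc N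
  in-range a∈ = proj₁ (A-bounded (suc N) a∈) ,
    ℕP.≤-trans (proj₂ (A-bounded (suc N) a∈)) (ℕP.≤-trans (r<16^n (suc N)) (ℕP.m≤m+n _ _))
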